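{- Let $S_3=\{p \text{ prime} : p\equiv 1 \bmod 3\}$ and $P_{S_3}=\{p \text{ prime} : p=x^2+3y^2+1 \text{ for some } x,y\in\mathbb{Z} \text{ with } \gcd(x,y)=1\}$. Then every $p\in P_{S_3}$ satisfies $(p-1)_{S_3}\geq (p-1)/12$.
   Context: For a set $S$ of primes and a natural number $n$, $n_S$ denotes the largest divisor of $n$ all of whose prime factors lie in $S$. -}

module Defs where

open import Data.Nat using (ℕ; _≤_; _%_; _∸_; _*_)
open import Data.Nat.Divisibility using (_∣_)
open import Data.Nat.Primality using (Prime)
open import Data.Integer as ℤ using (ℤ; +_)
open import Data.Integer.GCD as ℤG using ()
open import Data.Product using (_×_; ∃-syntax)
open import Relation.Binary.PropositionalEquality using (_≡_)

InS₃ : ℕ → Set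
InS₃ p = Prime p × (p % 3 ≡ 1)

AllPrimeFactorsInS₃ : ℕ → Set
AllPrimeFactorsInS₃ d = ∀ q → Prime q → q ∣ d → InS₃ q

IsS₃Part : ℕ → ℕ → Set
IsS₃Part n m = (m ∣ n) × AllPrimeFactorsInS₃ m
             × (∀ d → d ∣ n → AllPrimeFactorsInS₃ d → d ≤ m)

InPS₃ : ℕ → Set
InPS₃ p = Prime p × ∃[ x ] ∃[ y ]
  ((ℤG.gcd x y ≡ + 1) × (+ p ≡ x ℤ.* x ℤ.+ + 3 ℤ.* (y ℤ.* y) ℤ.+ + 1))

{-# OPTIONS --safe #-}
-- Write p - 1 = a² + 3b² with a = |x| and b = |y| coprime. A prime q ∤ 6 dividing a² + 3b² is
-- ≡ 1 (mod 3): if q ≡ 2 (mod 3), then by Fermat's little theorem cubing is injective modulo q, while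
-- (a - 3b)(a² + 3b²) = (a - b)³ - (2b)³ gives a - b ≡ 2b, so q ∣ 12b², impossible for coprime a, b.
-- Coprimality also rules out 8 ∣ a² + 3b² and 9 ∣ a² + 3b² (a check on residues), so removing the
-- factors 2 and 3 from p - 1 costs at most 4 · 3 = 12, and the cofactor is an S₃-number dividing p - 1.
module Submission where

open import Defs

module _ where
  open import Data.Nat.Base
  open import Data.Nat.Properties using (*-zeroʳ; *-identityˡ; *-identityʳ; *-comm; <⇒≱)
  open import Data.Nat.Combinatorics using (_C_; nC1≡n; nCk+nC[k+1]≡[n+1]C[k+1])
  open import Data.Nat.Divisibility using (_∣_; divides; ∣⇒≤)
  open import Data.Nat.Primality
    using (Prime; prime?; prime[2]; ¬prime[1]; euclidsLemma; prime⇒irreducible)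
  open import Data.Nat.Tactic.RingSolver using (solve-∀)
  open import Data.Sum.Base using (_⊎_; inj₁; inj₂)
  open import Data.Empty using (⊥-elim)
  open import Relation.Nullary.Decidable using (from-yes)
  open import Relation.Binary.PropositionalEquality

  [k+1]*[n+1]C[k+1]≡[n+1]*nCk : ∀ n k → suc k * (suc n C suc k) ≡ suc n * (n C k)
  [k+1]*[n+1]C[k+1]≡[n+1]*nCk zero    zero    = refl
  [k+1]*[n+1]C[k+1]≡[n+1]*nCk zero    (suc k) = *-zeroʳ (2 + k)
  [k+1]*[n+1]C[k+1]≡[n+1]*nCk (suc n) zero    =
    trans (*-identityˡ _) (trans (nC1≡n (2 + n)) (sym (*-identityʳ _)))
  [k+1]*[n+1]C[k+1]≡[n+1]*nCk (suc n) (suc k) = begin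
    (2 + k) * ((2 + n) C (2 + k))             ≡⟨ cong ((2 + k) *_) (sym (nCk+nC[k+1]≡[n+1]C[k+1] (suc n) (suc k))) ⟩
    (2 + k) * (X + Y)                        ≡⟨ regroupˡ k X Y ⟩
    ((1 + k) * X + X) + (2 + k) * Y          ≡⟨ cong₂ (λ u v → (u + X) + v) ([k+1]*[n+1]C[k+1]≡[n+1]*nCk n k)
                                                                            ([k+1]*[n+1]C[k+1]≡[n+1]*nCk n (suc k)) ⟩
    ((1 + n) * (n C k) + X) + (1 + n) * (n C suc k) ≡⟨ regroupʳ (1 + n) X (n C k) (n C suc k) ⟩
    X + (1 + n) * (n C k + n C suc k)        ≡⟨ cong (λ u → X + (1 + n) * u) (nCk+nC[k+1]≡[n+1]C[k+1] n k) ⟩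
    X + (1 + n) * X                          ∎
    where
    open ≡-Reasoning
    X = (1 + n) C (1 + k)
    Y = (1 + n) C (2 + k)
    regroupˡ : ∀ k x y → (2 + k) * (x + y) ≡ ((1 + k) * x + x) + (2 + k) * y
    regroupˡ = solve-∀
    regroupʳ : ∀ m x u v → (m * u + x) + m * v ≡ x + m * (u + v)
    regroupʳ = solve-∀

  p∣pCk : ∀ {p k} → Prime p → 0 < k → k < p → p ∣ p C k
  p∣pCk {suc n} {suc k} p-prime _ (s≤s k<n)
    with euclidsLemma (suc k) (suc n C suc k) p-prime
           (divides (n C k) (trans ([k+1]*[n+1]C[k+1]≡[n+1]*nCk n k) (*-comm (suc n) (n C k))))
  ... | inj₁ p∣k = ⊥-elim (<⇒≱ (s≤s k<n) (∣⇒≤ p∣k))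
  ... | inj₂ p∣pCk = p∣pCk

  prime[3] : Prime 3
  prime[3] = from-yes (prime? 3)

  prime∣prime⇒≡ : ∀ {p q} → Prime p → Prime q → p ∣ q → p ≡ q
  prime∣prime⇒≡ p-prime q-prime p∣q with prime⇒irreducible q-prime p∣q
  ... | inj₁ refl = ⊥-elim (¬prime[1] p-prime)
  ... | inj₂ p≡q = p≡q

  prime∣12⇒≡2⊎≡3 : ∀ {p} → Prime p → p ∣ 12 → p ≡ 2 ⊎ p ≡ 3
  prime∣12⇒≡2⊎≡3 p-prime p∣12 with euclidsLemma 2 6 p-prime p∣12
  ... | inj₁ p∣2 = inj₁ (prime∣prime⇒≡ p-prime prime[2] p∣2)
  ... | inj₂ p∣6 with euclidsLemma 2 3 p-prime p∣6
  ...   | inj₁ p∣2 = inj₁ (prime∣prime⇒≡ p-prime prime[2] p∣2)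
  ...   | inj₂ p∣3 = inj₂ (prime∣prime⇒≡ p-prime prime[3] p∣3)

module _ where
  open import Data.Nat.Base as ℕ using (ℕ; zero; suc; z≤n; s≤s)
  import Data.Nat.Properties as ℕ
  import Data.Nat.DivMod as ℕ
  import Data.Nat.Divisibility as ℕ
  import Data.Nat.Tactic.RingSolver as ℕ-Solver
  open import Data.Nat.Combinatorics using (_C_; nCn≡1)
  open import Data.Nat.Primality using (Prime; euclidsLemma)
  open import Data.Integer.Base hiding (suc)
  open import Data.Integer.Properties
    using ( +-*-semiring; +-*-commutativeSemiring; +-identityʳ; *-identityˡ; *-identityʳ
          ; ^-zeroˡ; ^-*-assoc; ^-distribˡ-+-*; abs-* )
  open import Data.Integer.Divisibility.Signed
  open import Data.Integer.Tactic.RingSolver using (solve-∀)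
  open import Data.Fin.Base as Fin using (Fin; toℕ; inject₁; fromℕ)
  import Data.Fin.Properties as Fin
  open import Data.Vec.Functional using (init; tail)
  open import Data.Sum.Base as Sum using (_⊎_; inj₁; inj₂; reduce; fromInj₂)
  open import Function.Base using (_∘_)
  open import Relation.Nullary using (¬_; contradiction)
  open import Relation.Binary.PropositionalEquality
  import Algebra.Properties.CommutativeSemiring.Binomial +-*-commutativeSemiring as Binomial
  open import Algebra.Properties.Semiring.Sum +-*-semiring using (sum; sum-init-last)
  open import Algebra.Properties.Semiring.Mult +-*-semiring using (_×_)
  open import Algebra.Properties.Semiring.Exp +-*-semiring using () renaming (_^_ to _^ᴿ_)

  ∣-sum : ∀ {k n} (f : Fin n → ℤ) → (∀ i → k ∣ f i) → k ∣ sum f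
  ∣-sum {n = zero}  f k∣f = ∣ᵤ⇒∣ (ℕ._∣0 _)
  ∣-sum {n = suc n} f k∣f = ∣m∣n⇒∣m+n (k∣f Fin.zero) (∣-sum (tail f) (k∣f ∘ Fin.suc))

  n×x≡+n*x : ∀ n x → n × x ≡ + n * x
  n×x≡+n*x zero    x = refl
  n×x≡+n*x (suc n) x = trans (cong (_+_ x) (n×x≡+n*x n x)) (distrib x (+ n))
    where
    distrib : ∀ x m → x + m * x ≡ (1ℤ + m) * x
    distrib = solve-∀

  ∣⇒∣× : ∀ {k n} x → k ℕ.∣ n → + k ∣ n × x
  ∣⇒∣× {n = n} x k∣n = subst (_ ∣_) (sym (n×x≡+n*x n x)) (∣m⇒∣m*n x (∣ᵤ⇒∣ {i = + n} k∣n))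

  x^ᴿn≡x^n : ∀ x n → x ^ᴿ n ≡ x ^ n
  x^ᴿn≡x^n x zero    = refl
  x^ᴿn≡x^n x (suc n) = cong (x *_) (x^ᴿn≡x^n x n)

  -- The ring solver does not handle _^_, so cubes are unfolded through this lemma; leaving that to
  -- conversion checking instead makes Agda unfold ℤ's _*_ at prohibitive cost.
  x³≡x*x*x : ∀ x → x ^ 3 ≡ x * (x * (x * 1ℤ))
  x³≡x*x*x x = refl

  ∣x-y⇒∣xⁿ-yⁿ : ∀ {k x y} n → k ∣ x - y → k ∣ x ^ n - y ^ n
  ∣x-y⇒∣xⁿ-yⁿ zero    _     = ∣ᵤ⇒∣ (ℕ._∣0 _)
  ∣x-y⇒∣xⁿ-yⁿ {x = x} {y} (suc n) k∣x-y =
    subst (_ ∣_) (telescope x y (x ^ n) (y ^ n))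
      (∣m∣n⇒∣m+n (∣n⇒∣m*n x (∣x-y⇒∣xⁿ-yⁿ n k∣x-y)) (∣n⇒∣m*n (y ^ n) k∣x-y))
    where
    telescope : ∀ x y u v → x * (u - v) + v * (x - y) ≡ x * u - y * v
    telescope = solve-∀

  prime∣*⇒∣⊎∣ : ∀ {p} → Prime p → ∀ x y → + p ∣ x * y → (+ p ∣ x) ⊎ (+ p ∣ y)
  prime∣*⇒∣⊎∣ {p} p-prime x y p∣xy =
    Sum.map ∣ᵤ⇒∣ ∣ᵤ⇒∣ (euclidsLemma ∣ x ∣ ∣ y ∣ p-prime (subst (p ℕ.∣_) (abs-* x y) (∣⇒∣ᵤ p∣xy)))

  freshmans-dream : ∀ {p} → Prime p → ∀ z → + p ∣ (1ℤ + z) ^ p - (z ^ p + 1ℤ)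
  freshmans-dream {suc r} p-prime z = subst (+ p ∣_) (sym expansion) (∣-sum middle p∣middle)
    where
    open ≡-Reasoning
    p = suc r
    term : Fin (suc p) → ℤ
    term = Binomial.binomialTerm 1ℤ z p
    middle : Fin r → ℤ
    middle = init (tail term)
    p∣middle : ∀ i → + p ∣ middle i
    p∣middle i = ∣⇒∣× (Binomial.binomial 1ℤ z p (Fin.suc (inject₁ i))) (p∣pCk p-prime (s≤s z≤n) (s≤s i<r))
      where
      i<r : toℕ (inject₁ i) ℕ.< r
      i<r = subst (ℕ._< r) (sym (Fin.toℕ-inject₁ i)) (Fin.toℕ<n i)
    first : term Fin.zero ≡ z ^ p
    first = begin
      1 × (1ℤ * z ^ᴿ p) ≡⟨ +-identityʳ _ ⟩
      1ℤ * z ^ᴿ p       ≡⟨ *-identityˡ _ ⟩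
      z ^ᴿ p            ≡⟨ x^ᴿn≡x^n z p ⟩
      z ^ p             ∎
    last : term (fromℕ p) ≡ 1ℤ
    last rewrite Fin.toℕ-fromℕ r | nCn≡1 p | ℕ.n∸n≡0 r = begin
      1 × (1ℤ ^ᴿ p * 1ℤ) ≡⟨ +-identityʳ _ ⟩
      1ℤ ^ᴿ p * 1ℤ       ≡⟨ *-identityʳ _ ⟩
      1ℤ ^ᴿ p            ≡⟨ x^ᴿn≡x^n 1ℤ p ⟩
      1ℤ ^ p             ≡⟨ ^-zeroˡ p ⟩
      1ℤ                 ∎
    cancel : ∀ u m → u + (m + 1ℤ) - (u + 1ℤ) ≡ m
    cancel = solve-∀
    expansion : (1ℤ + z) ^ p - (z ^ p + 1ℤ) ≡ sum middle
    expansion = begin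
      (1ℤ + z) ^ p - (z ^ p + 1ℤ)
        ≡⟨ cong (_- (z ^ p + 1ℤ)) (sym (x^ᴿn≡x^n (1ℤ + z) p)) ⟩
      (1ℤ + z) ^ᴿ p - (z ^ p + 1ℤ)
        ≡⟨ cong (_- (z ^ p + 1ℤ)) (Binomial.theorem p 1ℤ z) ⟩
      term Fin.zero + sum (tail term) - (z ^ p + 1ℤ)
        ≡⟨ cong (λ s → term Fin.zero + s - (z ^ p + 1ℤ)) (sum-init-last (tail term)) ⟩
      term Fin.zero + (sum middle + term (fromℕ p)) - (z ^ p + 1ℤ)
        ≡⟨ cong₂ (λ u v → u + (sum middle + v) - (z ^ p + 1ℤ)) first last ⟩
      z ^ p + (sum middle + 1ℤ) - (z ^ p + 1ℤ)
        ≡⟨ cancel (z ^ p) (sum middle) ⟩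
      sum middle ∎

  -- Induction over ℤ in both directions: by the freshman's dream, z and 1 + z satisfy Fermat together.
  fermat : ∀ {p} → Prime p → ∀ z → + p ∣ z ^ p - z
  fermat {suc r} p-prime = go
    where
    p = suc r
    shift : ∀ z → (1ℤ + z) ^ p - (1ℤ + z) ≡ ((1ℤ + z) ^ p - (z ^ p + 1ℤ)) + (z ^ p - z)
    shift z = regroup ((1ℤ + z) ^ p) (z ^ p) z
      where
      regroup : ∀ u w z → u - (1ℤ + z) ≡ (u - (w + 1ℤ)) + (w - z)
      regroup = solve-∀
    up : ∀ z → + p ∣ z ^ p - z → + p ∣ (1ℤ + z) ^ p - (1ℤ + z)
    up z p∣ = subst (+ p ∣_) (sym (shift z)) (∣m∣n⇒∣m+n (freshmans-dream p-prime z) p∣)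
    down : ∀ z → + p ∣ (1ℤ + z) ^ p - (1ℤ + z) → + p ∣ z ^ p - z
    down z p∣ = ∣m+n∣m⇒∣n (subst (+ p ∣_) (shift z) p∣) (freshmans-dream p-prime z)
    go : ∀ z → + p ∣ z ^ p - z
    go (+ zero)     = ∣ᵤ⇒∣ (ℕ._∣0 _)
    go (+ suc n)    = up (+ n) (go (+ n))
    go -[1+ zero ]  = down -[1+ zero ] (go 0ℤ)
    go -[1+ suc n ] = down -[1+ suc n ] (go -[1+ n ])

  -- For p = 3k + 2 we have 3 (2k + 1) = p + (p - 1), so cubing is inverted by the (2k + 1)-th power.
  cube-root : ∀ {p} k → Prime p → p ≡ 2 ℕ.+ k ℕ.* 3 → ∀ z → + p ∣ (z ^ 3) ^ (1 ℕ.+ k ℕ.* 2) - z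
  cube-root {p} k p-prime refl z = subst (λ e → + p ∣ e - z) (sym cube^e≡) (subst (+ p ∣_) regroup p∣)
    where
    r = 1 ℕ.+ k ℕ.* 3
    exponent : ∀ k → 3 ℕ.* (1 ℕ.+ k ℕ.* 2) ≡ (2 ℕ.+ k ℕ.* 3) ℕ.+ (1 ℕ.+ k ℕ.* 3)
    exponent = ℕ-Solver.solve-∀
    cube^e≡ : (z ^ 3) ^ (1 ℕ.+ k ℕ.* 2) ≡ z ^ p * z ^ r
    cube^e≡ = trans (^-*-assoc z 3 (1 ℕ.+ k ℕ.* 2)) (trans (cong (z ^_) (exponent k)) (^-distribˡ-+-* z p r))
    p∣ : + p ∣ z ^ r * (z ^ p - z) + (z ^ p - z)
    p∣ = ∣m∣n⇒∣m+n (∣n⇒∣m*n (z ^ r) (fermat p-prime z)) (fermat p-prime z)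
    regroup : z ^ r * (z ^ p - z) + (z ^ p - z) ≡ z ^ p * z ^ r - z
    regroup = identity z (z ^ r)
      where
      identity : ∀ z w → w * (z * w - z) + (z * w - z) ≡ z * w * w - z
      identity = solve-∀

  cube-injective : ∀ {p x y} → Prime p → p ℕ.% 3 ≡ 2 → + p ∣ x ^ 3 - y ^ 3 → + p ∣ x - y
  cube-injective {p} {x} {y} p-prime p%3≡2 p∣x³-y³ =
    subst (+ p ∣_) (regroup x y ((x ^ 3) ^ e) ((y ^ 3) ^ e))
      (∣m∣n⇒∣m+n (∣m∣n⇒∣m-n (∣x-y⇒∣xⁿ-yⁿ {x = x ^ 3} {y ^ 3} e p∣x³-y³) (root x)) (root y))
    where
    k = p ℕ./ 3
    e = 1 ℕ.+ k ℕ.* 2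
    p≡2+3k : p ≡ 2 ℕ.+ k ℕ.* 3
    p≡2+3k = trans (ℕ.m≡m%n+[m/n]*n p 3) (cong (ℕ._+ k ℕ.* 3) p%3≡2)
    root : ∀ z → + p ∣ (z ^ 3) ^ e - z
    root = cube-root k p-prime p≡2+3k
    regroup : ∀ x y u v → (u - v) - (u - x) + (v - y) ≡ x - y
    regroup = solve-∀

  [a-3b][a²+3b²]≡[a-b]³-[2b]³ : ∀ a b → (a - + 3 * b) * (a * a + + 3 * (b * b)) ≡ (a - b) ^ 3 - (+ 2 * b) ^ 3
  [a-3b][a²+3b²]≡[a-b]³-[2b]³ a b = trans (expanded a b) (sym (cong₂ _-_ (x³≡x*x*x (a - b)) (x³≡x*x*x (+ 2 * b))))
    where
    expanded : ∀ a b → (a - + 3 * b) * (a * a + + 3 * (b * b))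
                     ≡ (a - b) * ((a - b) * ((a - b) * 1ℤ)) - + 2 * b * (+ 2 * b * (+ 2 * b * 1ℤ))
    expanded = solve-∀

  a²+3b²-[a+3b][a-b-2b]≡12b² : ∀ a b → a * a + + 3 * (b * b) - (a + + 3 * b) * ((a - b) - + 2 * b) ≡ + 12 * (b * b)
  a²+3b²-[a+3b][a-b-2b]≡12b² = solve-∀

  p∣a²+3b²⇒p∣b : ∀ {p} → Prime p → p ≢ 2 → p ℕ.% 3 ≡ 2 → ∀ a b → + p ∣ a * a + + 3 * (b * b) → + p ∣ b
  p∣a²+3b²⇒p∣b {p} p-prime p≢2 p%3≡2 a b p∣norm = reduce (prime∣*⇒∣⊎∣ p-prime b b p∣b²)
    where
    A≡B : + p ∣ (a - b) - + 2 * b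
    A≡B = cube-injective {x = a - b} {+ 2 * b} p-prime p%3≡2
            (subst (+ p ∣_) ([a-3b][a²+3b²]≡[a-b]³-[2b]³ a b) (∣n⇒∣m*n (a - + 3 * b) p∣norm))
    p∣12b² : + p ∣ + 12 * (b * b)
    p∣12b² = subst (+ p ∣_) (a²+3b²-[a+3b][a-b-2b]≡12b² a b) (∣m∣n⇒∣m-n p∣norm (∣n⇒∣m*n (a + + 3 * b) A≡B))
    p∤12 : ¬ p ℕ.∣ 12
    p∤12 p∣12 with prime∣12⇒≡2⊎≡3 p-prime p∣12
    ... | inj₁ p≡2 = p≢2 p≡2
    ... | inj₂ p≡3 = contradiction (subst (λ q → q ℕ.% 3 ≡ 2) p≡3 p%3≡2) λ ()
    p∣b² : + p ∣ b * b
    p∣b² = fromInj₂ (λ p∣12 → contradiction (∣⇒∣ᵤ p∣12) p∤12) (prime∣*⇒∣⊎∣ p-prime (+ 12) (b * b) p∣12b²)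

open import Data.Nat.Base
open import Data.Nat.Properties
  using (+-comm; *-identityˡ; *-identityʳ; *-assoc; ≤-trans; *-comm; *-monoʳ-≤; *-mono-≤; m^n>0; m+n∸n≡m; ≤-refl)
open import Data.Nat.DivMod using (m≡m%n+[m/n]*n; m%n<n)
open import Data.Nat.Divisibility
open import Data.Nat.Coprimality using (Coprime; gcd≡1⇒coprime)
open import Data.Nat.Primality using (Prime; ¬prime[1]; euclidsLemma)
open import Data.Nat.Tactic.RingSolver using (solve-∀)
import Data.Integer.Base as ℤ
import Data.Integer.Properties as ℤ
import Data.Integer.Divisibility.Signed as ℤ
open import Data.Fin.Base using (Fin; toℕ; fromℕ<)
open import Data.Fin.Properties using (all?; toℕ-fromℕ<)
open import Data.Product using (∃; ∃₂; _×_; _,_; proj₁; proj₂)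
open import Data.Sum.Base using (reduce)
open import Data.Empty using (⊥-elim)
open import Function.Base using (case_of_)
open import Relation.Nullary using (¬_; yes; no; contradiction)
open import Relation.Nullary.Decidable using (from-yes; _×-dec_; _→-dec_)
open import Relation.Binary.PropositionalEquality

norm : ℕ → ℕ → ℕ
norm a b = a * a + 3 * (b * b)

+norm≡ : ∀ x y → ℤ.+ norm ℤ.∣ x ∣ ℤ.∣ y ∣ ≡ x ℤ.* x ℤ.+ ℤ.+ 3 ℤ.* (y ℤ.* y)
+norm≡ x y = begin
  ℤ.+ (∣x∣ * ∣x∣ + 3 * (∣y∣ * ∣y∣))               ≡⟨ ℤ.pos-+ (∣x∣ * ∣x∣) (3 * (∣y∣ * ∣y∣)) ⟩
  ℤ.+ (∣x∣ * ∣x∣) ℤ.+ ℤ.+ (3 * (∣y∣ * ∣y∣))        ≡⟨ cong (ℤ._+_ (ℤ.+ (∣x∣ * ∣x∣))) (ℤ.pos-* 3 (∣y∣ * ∣y∣)) ⟩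
  ℤ.+ (∣x∣ * ∣x∣) ℤ.+ ℤ.+ 3 ℤ.* ℤ.+ (∣y∣ * ∣y∣)    ≡⟨ cong₂ (λ u v → u ℤ.+ ℤ.+ 3 ℤ.* v) (square x) (square y) ⟩
  x ℤ.* x ℤ.+ ℤ.+ 3 ℤ.* (y ℤ.* y)                 ∎
  where
  open ≡-Reasoning
  ∣x∣ = ℤ.∣ x ∣
  ∣y∣ = ℤ.∣ y ∣
  square : ∀ i → ℤ.+ (ℤ.∣ i ∣ * ℤ.∣ i ∣) ≡ i ℤ.* i
  square (ℤ.+ n)     = ℤ.pos-* n n
  square ℤ.-[1+ n ]  = refl

norm-mod : ∀ M .{{_ : NonZero M}} a b → M ∣ norm a b → M ∣ norm (a % M) (b % M)
norm-mod M a b M∣norm = ∣m+n∣m⇒∣n M∣expansion (m∣m*n _)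
  where
  expand : ∀ r s k l M → (r + k * M) * (r + k * M) + 3 * ((s + l * M) * (s + l * M))
                         ≡ M * (k * (2 * r + k * M) + 3 * l * (2 * s + l * M)) + (r * r + 3 * (s * s))
  expand = solve-∀
  M∣expansion : M ∣ M * (a / M * (2 * (a % M) + a / M * M) + 3 * (b / M) * (2 * (b % M) + b / M * M))
                      + norm (a % M) (b % M)
  M∣expansion = subst (M ∣_) (expand (a % M) (b % M) (a / M) (b / M) M)
    (subst₂ (λ u v → M ∣ norm u v) (m≡m%n+[m/n]*n a M) (m≡m%n+[m/n]*n b M) M∣norm)

common-factor-of-norm : ∀ M d .{{_ : NonZero M}} → d ∣ M →
                        (∀ (r s : Fin M) → M ∣ norm (toℕ r) (toℕ s) → d ∣ toℕ r × d ∣ toℕ s) →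
                        ∀ a b → M ∣ norm a b → d ∣ a × d ∣ b
common-factor-of-norm M d d∣M residues a b M∣norm =
  ∣n∣m%n⇒∣m d∣M (proj₁ d∣residues) , ∣n∣m%n⇒∣m d∣M (proj₂ d∣residues)
  where
  a<M = m%n<n a M
  b<M = m%n<n b M
  d∣residues : d ∣ a % M × d ∣ b % M
  d∣residues = subst₂ (λ u v → d ∣ u × d ∣ v) (toℕ-fromℕ< a<M) (toℕ-fromℕ< b<M)
    (residues (fromℕ< a<M) (fromℕ< b<M)
      (subst₂ (λ u v → M ∣ norm u v) (sym (toℕ-fromℕ< a<M)) (sym (toℕ-fromℕ< b<M)) (norm-mod M a b M∣norm)))

coprime⇒8∤norm : ∀ {a b} → Coprime a b → ¬ 8 ∣ norm a b
coprime⇒8∤norm {a} {b} coprime 8∣norm =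
  case coprime (common-factor-of-norm 8 2 (divides 4 refl) residues a b 8∣norm) of λ ()
  where
  residues : ∀ (r s : Fin 8) → 8 ∣ norm (toℕ r) (toℕ s) → 2 ∣ toℕ r × 2 ∣ toℕ s
  residues = from-yes (all? λ (r : Fin 8) → all? λ (s : Fin 8) →
    (8 ∣? norm (toℕ r) (toℕ s)) →-dec ((2 ∣? toℕ r) ×-dec (2 ∣? toℕ s)))

coprime⇒9∤norm : ∀ {a b} → Coprime a b → ¬ 9 ∣ norm a b
coprime⇒9∤norm {a} {b} coprime 9∣norm =
  case coprime (common-factor-of-norm 9 3 (divides 3 refl) residues a b 9∣norm) of λ ()
  where
  residues : ∀ (r s : Fin 9) → 9 ∣ norm (toℕ r) (toℕ s) → 3 ∣ toℕ r × 3 ∣ toℕ s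
  residues = from-yes (all? λ (r : Fin 9) → all? λ (s : Fin 9) →
    (9 ∣? norm (toℕ r) (toℕ s)) →-dec ((3 ∣? toℕ r) ×-dec (3 ∣? toℕ s)))

split-power : ∀ p k n .{{_ : NonZero p}} → ¬ p ^ suc k ∣ n → ∃₂ λ e d → n ≡ e * d × e ≤ p ^ k × ¬ p ∣ d
split-power p k n pᵏ⁺¹∤n with p ∣? n
... | no p∤n = 1 , n , sym (*-identityˡ n) , m^n>0 p k , p∤n
split-power p zero n p∤n | yes p∣n = contradiction (subst (_∣ n) (sym (*-identityʳ p)) p∣n) p∤n
split-power p (suc k) n pᵏ⁺²∤n | yes (divides n′ refl)
  with split-power p k n′ (λ pᵏ⁺¹∣n′ → pᵏ⁺²∤n (subst (_∣ n′ * p) (*-comm (p ^ suc k) p) (*-monoˡ-∣ p pᵏ⁺¹∣n′)))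
... | e , d , refl , e≤pᵏ , p∤d = p * e , d , reassoc e d p , *-monoʳ-≤ p e≤pᵏ , p∤d
  where
  reassoc : ∀ e d p → e * d * p ≡ p * e * d
  reassoc = solve-∀

divisor-coprime-to-6 : ∀ n → ¬ 8 ∣ n → ¬ 9 ∣ n → ∃ λ d → d ∣ n × ¬ 2 ∣ d × ¬ 3 ∣ d × n ≤ 12 * d
divisor-coprime-to-6 n 8∤n 9∤n with split-power 2 2 n 8∤n
... | e₁ , d₁ , refl , e₁≤4 , 2∤d₁ with split-power 3 1 d₁ (λ 9∣d₁ → 9∤n (∣-trans 9∣d₁ (n∣m*n e₁)))
... | e₂ , d , refl , e₂≤3 , 3∤d =
  d , ∣-trans (n∣m*n e₂) (n∣m*n e₁) , (λ 2∣d → 2∤d₁ (∣-trans 2∣d (n∣m*n e₂))) , 3∤d , bound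
  where
  bound : e₁ * (e₂ * d) ≤ 12 * d
  bound = subst (e₁ * (e₂ * d) ≤_) (sym (*-assoc 4 3 d)) (*-mono-≤ e₁≤4 (*-mono-≤ e₂≤3 (≤-refl {d})))

prime∣norm⇒≡1[mod3] : ∀ {a b q} → Coprime a b → Prime q → q ≢ 2 → q ≢ 3 → q ∣ norm a b → q % 3 ≡ 1
prime∣norm⇒≡1[mod3] {a} {b} {q} coprime q-prime q≢2 q≢3 q∣norm with q % 3 in q%3≡r | m%n<n q 3
... | 0 | _ = contradiction (sym (prime∣prime⇒≡ prime[3] q-prime (m%n≡0⇒n∣m q 3 q%3≡r))) q≢3
... | 1 | _ = refl
... | 2 | _ = ⊥-elim (¬prime[1] (subst Prime (coprime (q∣a , q∣b)) q-prime))
  where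
  q∣b : q ∣ b
  q∣b = ℤ.∣⇒∣ᵤ (p∣a²+3b²⇒p∣b q-prime q≢2 q%3≡r (ℤ.+ a) (ℤ.+ b)
                  (subst (ℤ.+ q ℤ.∣_) (+norm≡ (ℤ.+ a) (ℤ.+ b)) (ℤ.∣ᵤ⇒∣ q∣norm)))
  q∣a : q ∣ a
  q∣a = reduce (euclidsLemma a a q-prime
          (∣m+n∣m⇒∣n (subst (q ∣_) (+-comm (a * a) _) q∣norm) (∣n⇒∣m*n 3 (∣m⇒∣m*n b q∣b))))
... | suc (suc (suc _)) | s≤s (s≤s (s≤s ()))

norm-divisor-in-S₃ : ∀ {a b d} → Coprime a b → d ∣ norm a b → ¬ 2 ∣ d → ¬ 3 ∣ d → AllPrimeFactorsInS₃ d
norm-divisor-in-S₃ coprime d∣norm 2∤d 3∤d q q-prime q∣d =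
  q-prime , prime∣norm⇒≡1[mod3] coprime q-prime (λ { refl → 2∤d q∣d }) (λ { refl → 3∤d q∣d }) (∣-trans q∣d d∣norm)

coprime⇒norm≤12*S₃-part : ∀ {a b m} → Coprime a b → IsS₃Part (norm a b) m → norm a b ≤ 12 * m
coprime⇒norm≤12*S₃-part {a} {b} {m} coprime (_ , _ , maximal) =
  from-divisor (divisor-coprime-to-6 (norm a b) (coprime⇒8∤norm coprime) (coprime⇒9∤norm coprime))
  where
  from-divisor : (∃ λ d → d ∣ norm a b × ¬ 2 ∣ d × ¬ 3 ∣ d × norm a b ≤ 12 * d) → norm a b ≤ 12 * m
  from-divisor (d , d∣norm , 2∤d , 3∤d , norm≤12d) =
    ≤-trans norm≤12d (*-monoʳ-≤ 12 (maximal d d∣norm (norm-divisor-in-S₃ coprime d∣norm 2∤d 3∤d)))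

pred≡norm : ∀ {p} x y → ℤ.+ p ≡ x ℤ.* x ℤ.+ ℤ.+ 3 ℤ.* (y ℤ.* y) ℤ.+ ℤ.+ 1 → p ∸ 1 ≡ norm ℤ.∣ x ∣ ℤ.∣ y ∣
pred≡norm {p} x y p≡ = trans (cong (_∸ 1) (ℤ.+-injective p≡norm+1)) (m+n∸n≡m _ 1)
  where
  p≡norm+1 : ℤ.+ p ≡ ℤ.+ (norm ℤ.∣ x ∣ ℤ.∣ y ∣ + 1)
  p≡norm+1 = trans p≡ (sym (trans (ℤ.pos-+ _ 1) (cong (ℤ._+ ℤ.+ 1) (+norm≡ x y))))

corollary2p8 : ∀ (p m : ℕ) → InPS₃ p → IsS₃Part (p ∸ 1) m → p ∸ 1 ≤ 12 * m
corollary2p8 p m (_ , x , y , gcd≡1 , p≡) =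
  subst (λ n → IsS₃Part n m → n ≤ 12 * m) (sym (pred≡norm x y p≡)) (coprime⇒norm≤12*S₃-part coprime)
  where
  coprime : Coprime ℤ.∣ x ∣ ℤ.∣ y ∣
  coprime = gcd≡1⇒coprime (ℤ.+-injective gcd≡1)
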